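{- Let $G$ be a Dedekind group and let $\pi=\{C_1,\dots,C_\ell\}$ be a collection of $\ell$ distinct subsets of $G$, each of size $k$ and containing $e$, pairwise intersecting exactly in $\{e\}$ and satisfying the $T$-axiom, such that the Cayley incidence graph $\mathrm{BCay}(G,\pi)$ is $\beta$-transitive. Then $\ell=1$ or $\ell=k$.
   Context: A Dedekind group is a group in which every subgroup is normal. For $C\subseteq G$ and $g\in G$, $gC=\{gs:s\in C\}$. A collection $\pi$ of subsets of $G$, each containing $e$, satisfies the $T$-axiom if for every $C\in\pi$ and $s\in C$, $s^{ -1}C\in\pi$. The Cayley incidence graph $\mathrm{BCay}(G,\pi)$ is the bipartite graph with parts $\gamma=G$ and $\beta=\{gC:g\in G,C\in\pi\}$, with $g$ adjacent to $gC$ for every $g\in G$, $C\in\pi$. It is $\beta$-transitive if for every $C_i,C_j\in\pi$ there is $s\in C_i$ with $s^{ -1}C_i=C_j$. -}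

module Defs where

open import Level using (Level; _⊔_; suc)
open import Algebra.Bundles using (Group)
open import Data.Nat using (ℕ)
open import Data.Fin using (Fin)
open import Data.Product using (Σ; ∃; _×_; _,_)
open import Relation.Binary.PropositionalEquality using (_≡_)
open import Relation.Nullary using (¬_)

module GroupDefs {c ℓ : Level} (G : Group c ℓ) where
  open Group G

  record IsSubgroup (H : Carrier → Set (c ⊔ ℓ)) : Set (c ⊔ ℓ) where
    field
      resp : ∀ {x y} → x ≈ y → H x → H y
      has-ε : H ε
      closed-∙ : ∀ {x y} → H x → H y → H (x ∙ y)
      closed-⁻¹ : ∀ {x} → H x → H (x ⁻¹)

  IsNormal : (Carrier → Set (c ⊔ ℓ)) → Set (c ⊔ ℓ)
  IsNormal H = ∀ g {h} → H h → H ((g ∙ h) ∙ g ⁻¹)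

  IsDedekind : Set (suc (c ⊔ ℓ))
  IsDedekind = ∀ (H : Carrier → Set (c ⊔ ℓ)) → IsSubgroup H → IsNormal H

  -- A finite subset of size k, given by an injective (w.r.t. ≈) enumeration.
  Subset : ℕ → Set c
  Subset k = Fin k → Carrier

  HasSize : ∀ {k} → Subset k → Set ℓ
  HasSize {k} C = ∀ (a b : Fin k) → C a ≈ C b → a ≡ b

  _∈_ : ∀ {k} → Carrier → Subset k → Set ℓ
  _∈_ {k} x C = Σ (Fin k) λ a → x ≈ C a

  _·_ : ∀ {k} → Carrier → Subset k → Subset k
  (g · C) a = g ∙ C a

  _≐_ : ∀ {k m} → Subset k → Subset m → Set (c ⊔ ℓ)
  C ≐ D = (∀ x → x ∈ C → x ∈ D) × (∀ x → x ∈ D → x ∈ C)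

  TAxiom : ∀ {n k} → (Fin n → Subset k) → Set (c ⊔ ℓ)
  TAxiom {n} C = ∀ i s → s ∈ C i → Σ (Fin n) λ j → ((s ⁻¹) · C i) ≐ C j

  βTransitive : ∀ {n k} → (Fin n → Subset k) → Set (c ⊔ ℓ)
  βTransitive C = ∀ i j → Σ Carrier λ s → s ∈ C i × ((s ⁻¹) · C i) ≐ C j

-- Write C for C₀. By the T-axiom every a ∈ C yields a block a⁻¹C of π, and by
-- β-transitivity together with distinctness every block arises this way. If
-- a⁻¹C = b⁻¹C, then h = ba⁻¹ lies in the setwise stabiliser of C; this is a
-- subgroup, hence normal because G is Dedekind. So h ∈ C (as e ∈ C), and for
-- any s ∈ C also shs⁻¹ stabilises C, whence sh ∈ C and h ∈ s⁻¹C. When ℓ ≥ 2,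
-- taking s ∈ C with s⁻¹C = C₁ gives h ∈ C₀ ∩ C₁ = {e}, so a = b. Hence
-- a ↦ a⁻¹C is a bijection from C onto π and ℓ = k.
module Submission where

open import Defs
open import Level using (Level; _⊔_)
open import Algebra.Bundles using (Group)
open import Data.Nat using (ℕ; zero; suc; _≤_)
open import Data.Fin using (Fin; zero; suc)
open import Data.Fin.Properties using (_≟_; cantor-schröder-bernstein)
open import Data.Product using (Σ; _×_; _,_; proj₁; proj₂)
open import Data.Sum using (_⊎_; inj₁; inj₂)
open import Function using (_∘_)
open import Function.Definitions using (Injective)
open import Relation.Binary.PropositionalEquality using (_≡_; _≢_)
import Relation.Binary.PropositionalEquality as ≡
open import Relation.Nullary using (¬_)
open import Relation.Nullary.Decidable using (decidable-stable)

injective∧surjective⇒≡ : ∀ {m n} {f : Fin m → Fin n} → Injective _≡_ _≡_ f →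
                         (∀ j → Σ (Fin m) λ a → f a ≡ j) → m ≡ n
injective∧surjective⇒≡ {f = f} f-inj f-surj = cantor-schröder-bernstein f-inj section-inj
  where
  section-inj : Injective _≡_ _≡_ (λ j → proj₁ (f-surj j))
  section-inj {i} {j} eq =
    ≡.trans (≡.sym (proj₂ (f-surj i))) (≡.trans (≡.cong f eq) (proj₂ (f-surj j)))

module _ {c ℓ : Level} (G : Group c ℓ) where
  open Group G
  open GroupDefs G
  open import Algebra.Properties.Group G
    using (\\-leftDividesˡ; \\-leftDividesʳ; //-rightDividesˡ; x∙y⁻¹≈ε⇒x≈y;
           ε⁻¹≈ε; ⁻¹-involutive; ⁻¹-anti-homo-∙)
  open import Relation.Binary.Reasoning.Setoid setoid

  _⊆_ : ∀ {k m} → Subset k → Subset m → Set (c ⊔ ℓ)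
  C ⊆ D = ∀ x → x ∈ C → x ∈ D

  ∈-resp-≈ : ∀ {k} {C : Subset k} {x y} → x ≈ y → x ∈ C → y ∈ C
  ∈-resp-≈ x≈y (a , x≈Ca) = a , trans (sym x≈y) x≈Ca

  ∈-translate : ∀ {k} {C : Subset k} g {x} → x ∈ C → (g ∙ x) ∈ (g · C)
  ∈-translate g (a , x≈Ca) = a , ∙-congˡ x≈Ca

  ∈-translate⁻¹ : ∀ {k} {C : Subset k} g {x} → x ∈ ((g ⁻¹) · C) → (g ∙ x) ∈ C
  ∈-translate⁻¹ {C = C} g (a , x≈g⁻¹Ca) = a , trans (∙-congˡ x≈g⁻¹Ca) (\\-leftDividesˡ g (C a))

  translate-cong : ∀ {k} (C : Subset k) {g h} → g ≈ h → (g · C) ⊆ (h · C)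
  translate-cong C g≈h x (a , x≈gCa) = a , trans x≈gCa (∙-congʳ g≈h)

  ≐-sym : ∀ {k m} {C : Subset k} {D : Subset m} → C ≐ D → D ≐ C
  ≐-sym (C⊆D , D⊆C) = D⊆C , C⊆D

  ≐-trans : ∀ {k m n} {C : Subset k} {D : Subset m} {E : Subset n} → C ≐ D → D ≐ E → C ≐ E
  ≐-trans (C⊆D , D⊆C) (D⊆E , E⊆D) = (λ x → D⊆E x ∘ C⊆D x) , (λ x → D⊆C x ∘ E⊆D x)

  Preserves : ∀ {k} → Subset k → Carrier → Set (c ⊔ ℓ)
  Preserves C g = ∀ {y} → y ∈ C → (g ∙ y) ∈ C

  Stabiliser : ∀ {k} → Subset k → Carrier → Set (c ⊔ ℓ)
  Stabiliser C g = Preserves C g × Preserves C (g ⁻¹)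

  module _ {k} {C : Subset k} where

    preserves-resp : ∀ {g h} → g ≈ h → Preserves C g → Preserves C h
    preserves-resp g≈h g-pres y∈C = ∈-resp-≈ (∙-congʳ g≈h) (g-pres y∈C)

    preserves-ε : Preserves C ε
    preserves-ε {y} = ∈-resp-≈ (sym (identityˡ y))

    preserves-∙ : ∀ {g h} → Preserves C g → Preserves C h → Preserves C (g ∙ h)
    preserves-∙ g-pres h-pres y∈C = ∈-resp-≈ (sym (assoc _ _ _)) (g-pres (h-pres y∈C))

    stabiliser-isSubgroup : IsSubgroup (Stabiliser C)
    stabiliser-isSubgroup = record
      { resp      = λ g≈h (g-pres , g⁻¹-pres) →
                      preserves-resp g≈h g-pres , preserves-resp (⁻¹-cong g≈h) g⁻¹-pres
      ; has-ε     = preserves-ε , preserves-resp (sym ε⁻¹≈ε) preserves-ε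
      ; closed-∙  = λ (g-pres , g⁻¹-pres) (h-pres , h⁻¹-pres) →
                      preserves-∙ g-pres h-pres
                    , preserves-resp (sym (⁻¹-anti-homo-∙ _ _)) (preserves-∙ h⁻¹-pres g⁻¹-pres)
      ; closed-⁻¹ = λ (g-pres , g⁻¹-pres) →
                      g⁻¹-pres , preserves-resp (sym (⁻¹-involutive _)) g-pres
      }

    preserves⇒∈ : ∀ {g} → ε ∈ C → Preserves C g → g ∈ C
    preserves⇒∈ {g} ε∈C g-pres = ∈-resp-≈ (identityʳ g) (g-pres ε∈C)

    translate⊆⇒preserves : ∀ {x y} → ((x ⁻¹) · C) ⊆ ((y ⁻¹) · C) → Preserves C (y ∙ x ⁻¹)
    translate⊆⇒preserves {x} {y} x⁻¹C⊆y⁻¹C {z} z∈C =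
      ∈-resp-≈ (sym (assoc y (x ⁻¹) z))
        (∈-translate⁻¹ y (x⁻¹C⊆y⁻¹C (x ⁻¹ ∙ z) (∈-translate (x ⁻¹) z∈C)))

    translate-≐⇒stabiliser : ∀ {x y} → ((x ⁻¹) · C) ≐ ((y ⁻¹) · C) → Stabiliser C (y ∙ x ⁻¹)
    translate-≐⇒stabiliser {x} {y} (x⁻¹C⊆y⁻¹C , y⁻¹C⊆x⁻¹C) =
        translate⊆⇒preserves x⁻¹C⊆y⁻¹C
      , preserves-resp x∙y⁻¹≈[y∙x⁻¹]⁻¹ (translate⊆⇒preserves y⁻¹C⊆x⁻¹C)
      where
      x∙y⁻¹≈[y∙x⁻¹]⁻¹ : x ∙ y ⁻¹ ≈ (y ∙ x ⁻¹) ⁻¹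
      x∙y⁻¹≈[y∙x⁻¹]⁻¹ = begin
        x ∙ y ⁻¹          ≈⟨ ∙-congʳ (⁻¹-involutive x) ⟨
        x ⁻¹ ⁻¹ ∙ y ⁻¹    ≈⟨ ⁻¹-anti-homo-∙ y (x ⁻¹) ⟨
        (y ∙ x ⁻¹) ⁻¹     ∎

    conjugate-preserves⇒∈-translate : ∀ {s h} → s ∈ C → Preserves C ((s ∙ h) ∙ s ⁻¹) →
                                      h ∈ ((s ⁻¹) · C)
    conjugate-preserves⇒∈-translate {s} {h} s∈C shs⁻¹-pres
      with d , sh≈Cd ← ∈-resp-≈ (//-rightDividesˡ s (s ∙ h)) (shs⁻¹-pres s∈C)
      = d , trans (sym (\\-leftDividesʳ s h)) (∙-congˡ sh≈Cd)

    dedekind-stabiliser⊆translate : IsDedekind → ∀ {s} → s ∈ C → ∀ {h} → Stabiliser C h →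
                                    h ∈ ((s ⁻¹) · C)
    dedekind-stabiliser⊆translate dedekind {s} s∈C h-stab =
      conjugate-preserves⇒∈-translate s∈C
        (proj₁ (dedekind (Stabiliser C) stabiliser-isSubgroup s h-stab))

  module _ {l k} {C : Fin l → Subset k} (T : TAxiom C) (i : Fin l) where

    translateIndex : Fin k → Fin l
    translateIndex a = proj₁ (T i (C i a) (a , refl))

    translateIndex-≐ : ∀ a → (((C i a) ⁻¹) · C i) ≐ C (translateIndex a)
    translateIndex-≐ a = proj₂ (T i (C i a) (a , refl))

    translateIndex-injective : IsDedekind → HasSize (C i) → ε ∈ C i →
      ∀ {j} → (∀ x → x ∈ C i → x ∈ C j → x ≈ ε) →
      ∀ {s} → s ∈ C i → ((s ⁻¹) · C i) ⊆ C j →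
      Injective _≡_ _≡_ translateIndex
    translateIndex-injective dedekind size ε∈Cᵢ Cᵢ∩Cⱼ⊆ε s∈Cᵢ s⁻¹Cᵢ⊆Cⱼ {a} {b} fa≡fb =
      ≡.sym (size b a (x∙y⁻¹≈ε⇒x≈y (C i b) (C i a) h≈ε))
      where
      h-stab : Stabiliser (C i) (C i b ∙ C i a ⁻¹)
      h-stab = translate-≐⇒stabiliser
        (≐-trans (translateIndex-≐ a)
          (≡.subst (λ j → C j ≐ _) (≡.sym fa≡fb) (≐-sym (translateIndex-≐ b))))
      h≈ε : C i b ∙ C i a ⁻¹ ≈ ε
      h≈ε = Cᵢ∩Cⱼ⊆ε _ (preserves⇒∈ ε∈Cᵢ (proj₁ h-stab))
                      (s⁻¹Cᵢ⊆Cⱼ _ (dedekind-stabiliser⊆translate dedekind s∈Cᵢ h-stab))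

    translateIndex-surjective : (∀ j j′ → j ≢ j′ → ¬ (C j ≐ C j′)) → βTransitive C →
                                ∀ j → Σ (Fin k) λ a → translateIndex a ≡ j
    translateIndex-surjective distinct β j
      with s , (a , s≈Cᵢa) , s⁻¹Cᵢ≐Cⱼ ← β i j
      = a , decidable-stable (translateIndex a ≟ j)
              (λ fa≢j → distinct _ _ fa≢j (≐-trans (≐-sym (translateIndex-≐ a)) Cᵢa⁻¹Cᵢ≐Cⱼ))
      where
      Cᵢa⁻¹Cᵢ≐Cⱼ : (((C i a) ⁻¹) · C i) ≐ C j
      Cᵢa⁻¹Cᵢ≐Cⱼ = ≐-trans (translate-cong (C i) (⁻¹-cong (sym s≈Cᵢa))
                          , translate-cong (C i) (⁻¹-cong s≈Cᵢa))
                         s⁻¹Cᵢ≐Cⱼ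

lemma6p10 : ∀ {c ℓ : Level} (G : Group c ℓ) → let open GroupDefs G in
    IsDedekind →
    (l k : ℕ) → 1 ≤ l →
    (C : Fin l → Subset k) →
    (∀ i → HasSize (C i)) →
    (∀ i j → i ≢ j → ¬ (C i ≐ C j)) →
    (∀ i → Group.ε G ∈ C i) →
    (∀ i j → i ≢ j → ∀ x → x ∈ C i → x ∈ C j → Group._≈_ G x (Group.ε G)) →
    TAxiom C →
    βTransitive C →
    l ≡ 1 ⊎ l ≡ k
lemma6p10 _ _ (suc zero) _ _ _ _ _ _ _ _ _ = inj₁ ≡.refl
lemma6p10 G dedekind (suc (suc m)) k _ C size distinct ε∈ disjoint T β =
  inj₂ (≡.sym (injective∧surjective⇒≡ translateIndex₀-injective (translateIndex-surjective G T zero distinct β)))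
  where
  translateIndex₀-injective : Injective _≡_ _≡_ (translateIndex G T zero)
  translateIndex₀-injective with s , s∈C₀ , (s⁻¹C₀⊆C₁ , _) ← β zero (suc zero) =
    translateIndex-injective G T zero dedekind (size zero) (ε∈ zero)
      (disjoint zero (suc zero) (λ ())) s∈C₀ s⁻¹C₀⊆C₁
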